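{- The $2$-reverse pass sortable permutations (the permutations of rev-tier at most $1$) are precisely $\operatorname{Av}(2413,2431,23154)$, the permutations avoiding each of $2413$, $2431$ and $23154$.
   Context: A permutation $\pi\in S_n$ contains $\sigma\in S_k$ if there are indices $\alpha_1<\cdots<\alpha_k$ with $\pi_{\alpha_i}<\pi_{\alpha_j}$ iff $\sigma_i<\sigma_j$; otherwise $\pi$ avoids $\sigma$. Sorting procedure: a permutation $\pi$ is processed using an input sequence (initially $\pi_1,\ldots,\pi_n$), a stack and an output. Let $m$ be the smallest value not yet output. At each step: if the stack's top entry equals $m$, pop it to the output; otherwise, if the input is nonempty, push the next input entry onto the stack. When no move is possible and the stack is nonempty, the remaining stack entries are returned to the input in the reverse of their order in the previous input (i.e. listed from top of stack to bottom), and the procedure is repeated; each run is a reverse pass. The rev-tier $t_{\operatorname{rev}}(\pi)$ is the number of times entries must be returned to the input before the output is $1,2,\ldots,n$. A permutation is $k$-reverse pass sortable if $t_{\operatorname{rev}}(\pi)\le k-1$. -}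

module Defs where

open import Data.Nat using (ℕ; zero; suc; _<_; _≟_)
open import Data.List using (List; []; _∷_; length; lookup; map; upTo)
open import Data.List.Relation.Binary.Sublist.Propositional using (_⊆_)
open import Data.Fin using (Fin; cast)
open import Data.Product using (Σ; ∃; _×_; _,_)
open import Relation.Binary.PropositionalEquality using (_≡_)
open import Relation.Nullary using (¬_; yes; no)
open import Function.Bundles using (_⇔_)

oneTo : ℕ → List ℕ
oneTo n = map suc (upTo n)

OrderIso : List ℕ → List ℕ → Set
OrderIso τ σ =
  Σ (length τ ≡ length σ) λ eq →
    ∀ (i j : Fin (length τ)) →
      (lookup τ i < lookup τ j) ⇔ (lookup σ (cast eq i) < lookup σ (cast eq j))

Contains : List ℕ → List ℕ → Set
Contains π σ = ∃ λ τ → (τ ⊆ π) × OrderIso τ σ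

Avoids : List ℕ → List ℕ → Set
Avoids π σ = ¬ Contains π σ

-- Arguments: remaining input, stack (head = top),
-- m = smallest value not yet output.  Returns (stack left when no move
-- is possible, listed top to bottom ; new m).
pass : List ℕ → List ℕ → ℕ → List ℕ × ℕ
pass [] [] m = [] , m
pass (x ∷ xs) [] m = pass xs (x ∷ []) m
pass inp (s ∷ st) m with s ≟ m
... | yes _ = pass inp st (suc m)
pass [] (s ∷ st) m | no _ = (s ∷ st) , m
pass (x ∷ xs) (s ∷ st) m | no _ = pass xs (x ∷ s ∷ st) m

-- Number of times the remaining stack is returned to the input (listed
-- from top of stack to bottom, i.e. reversing their previous input order)
-- starting from input `inp` with smallest unoutput value m, with fuel.
returnsFuel : ℕ → List ℕ → ℕ → ℕ
returnsFuel zero inp m = zero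
returnsFuel (suc f) inp m with pass inp [] m
... | [] , _ = zero
... | st@(_ ∷ _) , m' = suc (returnsFuel f st m')

-- rev-tier of a permutation π of [1..n] (given as the list π₁,…,πₙ).
-- Every pass outputs at least one entry, so at most n passes occur and
-- fuel n+1 is never exhausted.
tRev : List ℕ → ℕ
tRev π = returnsFuel (suc (length π)) π 1

RevPassSortable : ℕ → List ℕ → Set
RevPassSortable k π = suc (tRev π) Data.Nat.≤ k

module Submission where

-- A pass over distinct values leaves on the stack precisely the values not
-- yet output, i.e. those ≥ the final m, in reverse input order (pass-stack).
-- Which values a pass outputs is governed by 231-occurrences: if a, b, c
-- occur in this order with c < a < b, the pass cannot output a
-- (Blocking.blocked); conversely, if the final m is left on the stack and the
-- input's values ≥ m form an interval, m is the "2" of a 231-occurrence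
-- (Stranded.pass-strands).  Applying both facts to the first and the second
-- pass (module FromEmpty) shows that rev-tier ≥ 2 is equivalent to an
-- Obstruction: a 231-occurrence a b c and a 132-occurrence z y x with a ≤ z,
-- which the first pass returns reversed as a 231-occurrence.  A case analysis
-- on the positions of c, y and x turns obstructions into occurrences of
-- 2413, 2431 or 23154 and back; pattern containment is translated into
-- explicit inequalities by filling a pattern with increasing values
-- (orderIso-ranked).

open import Defs
open import Data.Nat using (ℕ; zero; suc; _≤_; _<_; z≤n; s≤s; _≟_; _≤?_; _<?_)
open import Data.Nat.Properties
open import Data.Fin using (Fin; zero; suc; cast; #_)
open import Data.List using (List; []; _∷_; _++_; [_]; reverse; filter; length; lookup; map)
open import Data.List.Properties
  using (++-assoc; unfold-reverse; reverse-involutive; ++-identityʳ; filter-all; filter-++; filter-reject; length-map)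
open import Data.List.Membership.Propositional using (_∈_)
open import Data.List.Membership.Propositional.Properties
  using (∈-++⁺ˡ; ∈-++⁺ʳ; ∈-++⁻; ∈-filter⁺; ∈-filter⁻; ∈-map⁺; ∈-map⁻; ∈-upTo⁺; ∈-upTo⁻; ∈-lookup)
open import Data.List.Relation.Unary.Any using (here; there)
open import Data.List.Relation.Unary.Any.Properties using () renaming (reverse⁺ to ∈-reverse⁺; reverse⁻ to ∈-reverse⁻)
open import Data.List.Relation.Unary.All as All using (All; []; _∷_)
open import Data.List.Relation.Unary.AllPairs using (_∷_)
open import Data.List.Relation.Unary.Linked using (Linked; [-]; _∷_)
open import Data.List.Relation.Unary.Unique.Propositional using (Unique)
import Data.List.Relation.Unary.Unique.Propositional.Properties as Unique
open import Data.List.Relation.Binary.Permutation.Propositional using (_↭_; ↭-sym; ↭⇒↭ₛ)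
open import Data.List.Relation.Binary.Permutation.Propositional.Properties using (∈-resp-↭; ↭-reverse; shift)
open import Data.List.Relation.Binary.Sublist.Propositional using (_⊆_; []; _∷_; _∷ʳ_; ⊆-refl; ⊆-trans; from∈)
open import Data.List.Relation.Binary.Sublist.Propositional.Properties
  using (Any-resp-⊆; All-resp-⊆; ++⁺; ++⁺ˡ; ++⁺ʳ; reverse⁺; filter⁺; filter-⊆)
open import Data.Product using (Σ; _×_; _,_; proj₁; proj₂)
open import Data.Sum using (_⊎_; inj₁; inj₂; map₂; [_,_]′)
open import Data.Sum.Function.Propositional using (_⊎-⇔_)
open import Data.Empty using (⊥-elim)
open import Data.Unit using (⊤; tt)
open import Function.Base using (_∘_)
open import Relation.Binary.PropositionalEquality using (_≡_; _≢_; refl; sym; trans; cong; subst; subst₂; setoid)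
open import Relation.Binary.Definitions using (tri<; tri≈; tri>)
open import Relation.Nullary using (Dec; yes; no)
open import Relation.Nullary.Decidable using (True; toWitness; from-yes; _×-dec_)
open import Function.Bundles using (_⇔_; mk⇔; Equivalence)
open import Function.Properties.Equivalence using () renaming (trans to ⇔-trans; sym to ⇔-sym)
open import Relation.Nullary.Negation using (_¬-⊎_)

open import Data.List.Relation.Binary.Permutation.Setoid.Properties (setoid ℕ) using (Unique-resp-↭)

unique-shift : ∀ (xs : List ℕ) {s ys} → Unique (xs ++ s ∷ ys) → Unique (s ∷ xs ++ ys)
unique-shift xs {s} {ys} = Unique-resp-↭ (↭⇒↭ₛ (shift s xs ys))

unique-delete : ∀ (xs : List ℕ) {s ys} → Unique (xs ++ s ∷ ys) → Unique (xs ++ ys)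
unique-delete xs u with unique-shift xs u
... | _ ∷ u′ = u′

distinct-from : ∀ (xs : List ℕ) {s ys v} → Unique (xs ++ s ∷ ys) → v ∈ xs ++ ys → v ≢ s
distinct-from xs u v∈ with unique-shift xs u
... | s∉ ∷ _ = λ v≡s → All.lookup s∉ v∈ (sym v≡s)

∈-delete : ∀ (xs : List ℕ) {s ys v} → v ∈ xs ++ s ∷ ys → v ≢ s → v ∈ xs ++ ys
∈-delete xs {s} {ys} v∈ v≢s with ∈-resp-↭ (shift s xs ys) v∈
... | here v≡s = ⊥-elim (v≢s v≡s)
... | there v∈′ = v∈′

⊆-delete : ∀ (xs : List ℕ) {s ys} → xs ++ ys ⊆ xs ++ s ∷ ys
⊆-delete xs {s} = ++⁺ ⊆-refl (s ∷ʳ ⊆-refl)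

unique-⊆ : ∀ {xs ys : List ℕ} → xs ⊆ ys → Unique ys → Unique xs
unique-⊆ [] u = u
unique-⊆ (y ∷ʳ p) (_ ∷ u) = unique-⊆ p u
unique-⊆ (refl ∷ p) (y∉ ∷ u) = All-resp-⊆ p y∉ ∷ unique-⊆ p u

inSomeOrder : ∀ {p q} (π : List ℕ) → p ∈ π → q ∈ π → p ≢ q → (p ∷ q ∷ []) ⊆ π ⊎ (q ∷ p ∷ []) ⊆ π
inSomeOrder (h ∷ t) (here refl) (here refl) p≢q = ⊥-elim (p≢q refl)
inSomeOrder (h ∷ t) (here refl) (there q∈) _ = inj₁ (refl ∷ from∈ q∈)
inSomeOrder (h ∷ t) (there p∈) (here refl) _ = inj₂ (refl ∷ from∈ p∈)
inSomeOrder (h ∷ t) (there p∈) (there q∈) p≢q with inSomeOrder t p∈ q∈ p≢q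
... | inj₁ pq = inj₁ (h ∷ʳ pq)
... | inj₂ qp = inj₂ (h ∷ʳ qp)

glue : ∀ {p q rest} {π : List ℕ} → Unique π → (p ∷ q ∷ []) ⊆ π → (q ∷ rest) ⊆ π → (p ∷ q ∷ rest) ⊆ π
glue (_ ∷ u) (h ∷ʳ pq) (.h ∷ʳ qr) = h ∷ʳ glue u pq qr
glue (h∉ ∷ _) (h ∷ʳ pq) (refl ∷ qr) = ⊥-elim (All.lookup h∉ (Any-resp-⊆ pq (there (here refl))) refl)
glue _ (refl ∷ pq) (h ∷ʳ qr) = refl ∷ qr
glue (h∉ ∷ _) (refl ∷ pq) (refl ∷ qr) = ⊥-elim (All.lookup h∉ (Any-resp-⊆ pq (here refl)) refl)

-- The entries of a configuration (input, stack), listed as the stack would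
-- list them, top first, if all the remaining input were pushed.
pool : List ℕ → List ℕ → List ℕ
pool inp st = reverse inp ++ st

pool-push : ∀ (x : ℕ) xs st → pool (x ∷ xs) st ≡ pool xs (x ∷ st)
pool-push x xs st = trans (cong (_++ st) (unfold-reverse x xs)) (++-assoc (reverse xs) [ x ] st)

AtLeast : ℕ → List ℕ → Set
AtLeast m xs = ∀ {v} → v ∈ xs → m ≤ v

pass-output : ∀ inp {st m} → pass inp (m ∷ st) m ≡ pass inp st (suc m)
pass-output [] {st} {m} with m ≟ m
... | yes _ = refl
... | no m≢m = ⊥-elim (m≢m refl)
pass-output (x ∷ xs) {st} {m} with m ≟ m
... | yes _ = refl
... | no m≢m = ⊥-elim (m≢m refl)

pass-halt : ∀ {s st m} → s ≢ m → pass [] (s ∷ st) m ≡ (s ∷ st , m)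
pass-halt {s} {st} {m} s≢m with s ≟ m
... | yes s≡m = ⊥-elim (s≢m s≡m)
... | no _ = refl

pass-push : ∀ {x xs s st m} → s ≢ m → pass (x ∷ xs) (s ∷ st) m ≡ pass xs (x ∷ s ∷ st) m
pass-push {x} {xs} {s} {st} {m} s≢m with s ≟ m
... | yes s≡m = ⊥-elim (s≢m s≡m)
... | no _ = refl

pass-mono : ∀ inp st m → m ≤ proj₂ (pass inp st m)
pass-mono [] [] m = ≤-refl
pass-mono (x ∷ xs) [] m = pass-mono xs (x ∷ []) m
pass-mono inp (s ∷ st) m with s ≟ m
... | yes refl rewrite pass-output inp {st} {s} = ≤-trans (n≤1+n s) (pass-mono inp st (suc s))
pass-mono [] (s ∷ st) m | no s≢m rewrite pass-halt {s} {st} {m} s≢m = ≤-refl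
pass-mono (x ∷ xs) (s ∷ st) m | no s≢m rewrite pass-push {x} {xs} {s} {st} {m} s≢m = pass-mono xs (x ∷ s ∷ st) m

atLeast-output : ∀ (xs : List ℕ) {m st} → Unique (xs ++ m ∷ st) → AtLeast m (xs ++ m ∷ st) → AtLeast (suc m) (xs ++ st)
atLeast-output xs u m≤ {v} v∈ with m≤n⇒m<n∨m≡n (m≤ (Any-resp-⊆ (⊆-delete xs) v∈))
... | inj₁ m<v = m<v
... | inj₂ m≡v = ⊥-elim (distinct-from xs u v∈ (sym m≡v))

filter-delete : ∀ k (xs : List ℕ) {s ys} → s < k → filter (k ≤?_) (xs ++ s ∷ ys) ≡ filter (k ≤?_) (xs ++ ys)
filter-delete k xs {s} {ys} s<k = trans (filter-++ (k ≤?_) xs (s ∷ ys))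
  (trans (cong (filter (k ≤?_) xs ++_) (filter-reject (k ≤?_) (<⇒≱ s<k))) (sym (filter-++ (k ≤?_) xs ys)))

pass-stack : ∀ inp st m → Unique (pool inp st) → AtLeast m (pool inp st) →
             proj₁ (pass inp st m) ≡ filter (proj₂ (pass inp st m) ≤?_) (pool inp st)
pass-stack [] [] m u m≤ = refl
pass-stack (x ∷ xs) [] m u m≤ rewrite pool-push x xs [] = pass-stack xs (x ∷ []) m u m≤
pass-stack inp (s ∷ st) m u m≤ with s ≟ m
... | yes refl rewrite pass-output inp {st} {s} =
  trans (pass-stack inp st (suc s) (unique-delete (reverse inp) u) (atLeast-output (reverse inp) u m≤))
        (sym (filter-delete _ (reverse inp) (pass-mono inp st (suc s))))
pass-stack [] (s ∷ st) m u m≤ | no s≢m rewrite pass-halt {s} {st} {m} s≢m = sym (filter-all (m ≤?_) (All.tabulate m≤))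
pass-stack (x ∷ xs) (s ∷ st) m u m≤ | no s≢m rewrite pass-push {x} {xs} {s} {st} {m} s≢m | pool-push x xs (s ∷ st) =
  pass-stack xs (x ∷ s ∷ st) m u m≤

input≢top : ∀ inp {s st v} → Unique (pool inp (s ∷ st)) → v ∈ inp → v ≢ s
input≢top inp u v∈ = distinct-from (reverse inp) u (∈-++⁺ˡ (∈-reverse⁺ v∈))

below≢top : ∀ inp {s st v} → Unique (pool inp (s ∷ st)) → v ∈ st → v ≢ s
below≢top inp u v∈ = distinct-from (reverse inp) u (∈-++⁺ʳ (reverse inp) v∈)

unique-push : ∀ (x : ℕ) xs st → Unique (pool (x ∷ xs) st) → Unique (pool xs (x ∷ st))
unique-push x xs st = subst Unique (pool-push x xs st)

-- If the input contains a, b, c in this order with c < a < b and c is not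
-- yet output, the pass ends before a is output: once a is on the stack, b is
-- pushed above it before c can be output, and b cannot leave before a.
module Blocking (a b c : ℕ) (c<a : c < a) (a<b : a < b) where

  b-above-a : ∀ inp st m → (b ∷ a ∷ []) ⊆ st → m ≤ a → Unique (pool inp st) → proj₂ (pass inp st m) ≤ a
  b-above-a inp (s ∷ st) m ba m≤a u with s ≟ m
  b-above-a inp (s ∷ st) m (.s ∷ʳ ba) m≤a u | yes refl rewrite pass-output inp {st} {s} =
    b-above-a inp st (suc s) ba (≤∧≢⇒< m≤a (λ s≡a → below≢top inp u (Any-resp-⊆ ba (there (here refl))) (sym s≡a)))
      (unique-delete (reverse inp) u)
  b-above-a inp (s ∷ st) m (refl ∷ _) m≤a u | yes refl = ⊥-elim (<⇒≱ a<b m≤a)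
  b-above-a [] (s ∷ st) m _ m≤a u | no s≢m rewrite pass-halt {s} {st} {m} s≢m = m≤a
  b-above-a (x ∷ xs) (s ∷ st) m ba m≤a u | no s≢m rewrite pass-push {x} {xs} {s} {st} {m} s≢m =
    b-above-a xs (x ∷ s ∷ st) m (x ∷ʳ ba) m≤a (unique-push x xs (s ∷ st) u)

  a-on-stack : ∀ inp st m → a ∈ st → (b ∷ c ∷ []) ⊆ inp → m ≤ c → Unique (pool inp st) → proj₂ (pass inp st m) ≤ a
  a-on-stack (x ∷ xs) (s ∷ st) m a∈ bc m≤c u with s ≟ m
  ... | yes refl with a∈
  ...   | here refl = ⊥-elim (<⇒≱ c<a m≤c)
  ...   | there a∈′ = a-on-stack (x ∷ xs) st (suc s) a∈′ bc
            (≤∧≢⇒< m≤c (λ s≡c → input≢top (x ∷ xs) u (Any-resp-⊆ bc (there (here refl))) (sym s≡c)))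
            (unique-delete (reverse (x ∷ xs)) u)
  a-on-stack (x ∷ xs) (s ∷ st) m a∈ (.x ∷ʳ bc) m≤c u | no _ =
    a-on-stack xs (x ∷ s ∷ st) m (there a∈) bc m≤c (unique-push x xs (s ∷ st) u)
  a-on-stack (x ∷ xs) (s ∷ st) m a∈ (refl ∷ bc) m≤c u | no _ =
    b-above-a xs (x ∷ s ∷ st) m (refl ∷ from∈ a∈) (≤-trans m≤c (<⇒≤ c<a)) (unique-push x xs (s ∷ st) u)

  blocked : ∀ inp st m → (a ∷ b ∷ c ∷ []) ⊆ inp → m ≤ c → Unique (pool inp st) → proj₂ (pass inp st m) ≤ a
  blocked (x ∷ xs) [] m (.x ∷ʳ abc) m≤c u = blocked xs (x ∷ []) m abc m≤c (unique-push x xs [] u)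
  blocked (x ∷ xs) [] m (refl ∷ bc) m≤c u = a-on-stack xs (x ∷ []) m (here refl) bc m≤c (unique-push x xs [] u)
  blocked (x ∷ xs) (s ∷ st) m abc m≤c u with s ≟ m
  ... | yes refl = blocked (x ∷ xs) st (suc s) abc
          (≤∧≢⇒< m≤c (λ s≡c → input≢top (x ∷ xs) u (Any-resp-⊆ abc (there (there (here refl)))) (sym s≡c)))
          (unique-delete (reverse (x ∷ xs)) u)
  blocked (x ∷ xs) (s ∷ st) m (.x ∷ʳ abc) m≤c u | no _ =
    blocked xs (x ∷ s ∷ st) m abc m≤c (unique-push x xs (s ∷ st) u)
  blocked (x ∷ xs) (s ∷ st) m (refl ∷ bc) m≤c u | no _ =
    a-on-stack xs (x ∷ s ∷ st) m (here refl) bc m≤c (unique-push x xs (s ∷ st) u)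

Occ231 : List ℕ → ℕ → Set
Occ231 π a = Σ ℕ λ b → Σ ℕ λ c → (a ∷ b ∷ c ∷ []) ⊆ π × c < a × a < b

ClosedFrom : List ℕ → ℕ → Set
ClosedFrom π m = ∀ {v w} → m ≤ v → v ≤ w → w ∈ π → v ∈ π

module Stranded (orig : List ℕ) where

  Witnessed : List ℕ → Set
  Witnessed [] = ⊤
  Witnessed (u ∷ []) = ⊤
  Witnessed (u ∷ l ∷ rest) =
    (l < u → Σ ℕ λ c → c < l × ((l ∷ u ∷ c ∷ []) ⊆ orig ⊎ c ∈ rest)) × Witnessed (l ∷ rest)

  witnessed-tail : ∀ {s st} → Witnessed (s ∷ st) → Witnessed st
  witnessed-tail {s} {[]} _ = tt
  witnessed-tail {s} {l ∷ rest} (_ , w) = w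

  -- If m lies strictly inside a witnessed stack of distinct values ≥ m, the
  -- entry u directly above it is larger, and the witness of the pair cannot
  -- lie deeper (it is < m); so m is the "2" of a 231-occurrence.
  strandedBelow : ∀ m u l rest → m ∈ l ∷ rest → Witnessed (u ∷ l ∷ rest) → AtLeast m (u ∷ l ∷ rest) →
                  Unique (u ∷ l ∷ rest) → Occ231 orig m
  strandedBelow m u .m rest (here refl) (w , _) m≤ (u∉ ∷ _) = witness (w m<u)
    where
    m<u : m < u
    m<u = ≤∧≢⇒< (m≤ (here refl)) (λ m≡u → All.lookup u∉ (here refl) (sym m≡u))
    witness : (Σ ℕ λ c → c < m × ((m ∷ u ∷ c ∷ []) ⊆ orig ⊎ c ∈ rest)) → Occ231 orig m
    witness (c , c<m , inj₁ muc) = u , c , muc , c<m , m<u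
    witness (c , c<m , inj₂ c∈) = ⊥-elim (<⇒≱ c<m (m≤ (there (there c∈))))
  strandedBelow m u l (l′ ∷ rest) (there m∈) (_ , w) m≤ (_ ∷ u′) = strandedBelow m l l′ rest m∈ w (m≤ ∘ there) u′

  stranded : ∀ {m} s st → s ≢ m → m ∈ s ∷ st → Witnessed (s ∷ st) → AtLeast m (s ∷ st) → Unique (s ∷ st) → Occ231 orig m
  stranded s st s≢m (here m≡s) _ _ _ = ⊥-elim (s≢m (sym m≡s))
  stranded {m} s (l ∷ rest) _ (there m∈) w m≤ u = strandedBelow m s l rest m∈ w m≤ u

  Retains : ℕ → List ℕ → Set
  Retains m w = ∀ {v} → m ≤ v → v ∈ orig → v ∈ w

  -- Main invariant argument: P is the part of orig already read, the stack
  -- lists read entries in reverse order, and the stack stays witnessed: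
  -- when s < x is pushed on s, the value m (< s, not yet output, hence still
  -- in the pool) is either unread input, giving the occurrence s x m, or
  -- lies deeper in the stack.
  pass-strands : ∀ inp st m P → orig ≡ P ++ inp → reverse st ⊆ P → Unique (pool inp st) → AtLeast m (pool inp st) →
                 Witnessed st → Retains m (pool inp st) → ClosedFrom orig m →
                 proj₂ (pass inp st m) ∈ proj₁ (pass inp st m) → Occ231 orig (proj₂ (pass inp st m))
  pass-strands [] [] m P e r u m≤ w ret cl ()
  pass-strands (x ∷ xs) [] m P e r u m≤ w ret cl h =
    pass-strands xs (x ∷ []) m (P ++ [ x ]) (trans e (sym (++-assoc P [ x ] xs))) (++⁺ˡ P ⊆-refl)
      (unique-push x xs [] u) (λ v∈ → m≤ (subst (_ ∈_) (sym (pool-push x xs [])) v∈)) tt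
      (λ m≤v v∈ → subst (_ ∈_) (pool-push x xs []) (ret m≤v v∈)) cl h
  pass-strands inp (s ∷ st) m P e r u m≤ w ret cl h with s ≟ m
  ... | yes refl rewrite pass-output inp {st} {s} =
    pass-strands inp st (suc s) P e (⊆-trans (++⁺ʳ [ s ] ⊆-refl) (subst (_⊆ P) (unfold-reverse s st) r))
      (unique-delete (reverse inp) u) (atLeast-output (reverse inp) u m≤) (witnessed-tail w)
      (λ s<v v∈ → ∈-delete (reverse inp) (ret (<⇒≤ s<v) v∈) (λ v≡s → <-irrefl (sym v≡s) s<v))
      (λ s<v v≤w w∈ → cl (<⇒≤ s<v) v≤w w∈) h
  pass-strands [] (s ∷ st) m P e r u m≤ w ret cl h | no s≢m rewrite pass-halt {s} {st} {m} s≢m =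
    stranded s st s≢m h w m≤ u
  pass-strands (x ∷ xs) (s ∷ st) m P e r u m≤ w ret cl h | no s≢m rewrite pass-push {x} {xs} {s} {st} {m} s≢m =
    pass-strands xs (x ∷ s ∷ st) m (P ++ [ x ]) e′ r′ (unique-push x xs (s ∷ st) u)
      (λ v∈ → m≤ (subst (_ ∈_) (sym (pool-push x xs (s ∷ st))) v∈)) (new-pair , w)
      (λ m≤v v∈ → subst (_ ∈_) (pool-push x xs (s ∷ st)) (ret m≤v v∈)) cl h
    where
    e′ : orig ≡ (P ++ [ x ]) ++ xs
    e′ = trans e (sym (++-assoc P [ x ] xs))
    r′ : reverse (x ∷ s ∷ st) ⊆ P ++ [ x ]
    r′ = subst (_⊆ P ++ [ x ]) (sym (unfold-reverse x (s ∷ st))) (++⁺ r ⊆-refl)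
    m<s : m < s
    m<s = ≤∧≢⇒< (m≤ (∈-++⁺ʳ (reverse (x ∷ xs)) (here refl))) (λ m≡s → s≢m (sym m≡s))
    s∈P : s ∈ P
    s∈P = Any-resp-⊆ r (∈-reverse⁺ {xs = s ∷ st} (here refl))
    m∈pool : m ∈ reverse xs ++ x ∷ s ∷ st
    m∈pool = subst (_ ∈_) (pool-push x xs (s ∷ st))
               (ret ≤-refl (cl ≤-refl (<⇒≤ m<s) (subst (_ ∈_) (sym e) (∈-++⁺ˡ s∈P))))
    new-pair : s < x → Σ ℕ λ c → c < s × ((s ∷ x ∷ c ∷ []) ⊆ orig ⊎ c ∈ st)
    new-pair s<x with ∈-++⁻ (reverse xs) m∈pool
    ... | inj₁ m∈xs = m , m<s , inj₁ (subst ((s ∷ x ∷ m ∷ []) ⊆_) (sym e′)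
                                   (++⁺ (++⁺ (from∈ s∈P) ⊆-refl) (from∈ (∈-reverse⁻ m∈xs))))
    ... | inj₂ (here m≡x) = ⊥-elim (<-asym s<x (subst (_< s) m≡x m<s))
    ... | inj₂ (there (here m≡s)) = ⊥-elim (s≢m (sym m≡s))
    ... | inj₂ (there (there m∈st)) = m , m<s , inj₂ m∈st

⊆-filter : ∀ k {xs ys : List ℕ} → xs ⊆ ys → All (k ≤_) xs → xs ⊆ filter (k ≤?_) ys
⊆-filter k p k≤ = subst (_⊆ _) (filter-all (k ≤?_) k≤) (filter⁺ (k ≤?_) (k ≤?_) (λ { refl k≤v → k≤v }) p)

module FromEmpty (inp : List ℕ) (m : ℕ) (u : Unique inp) (m≤ : AtLeast m inp) where

  pool≡ : pool inp [] ≡ reverse inp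
  pool≡ = ++-identityʳ (reverse inp)

  ∈-pool⁺ : ∀ {v} → v ∈ inp → v ∈ pool inp []
  ∈-pool⁺ v∈ = subst (_ ∈_) (sym pool≡) (∈-reverse⁺ v∈)

  ∈-pool⁻ : ∀ {v} → v ∈ pool inp [] → v ∈ inp
  ∈-pool⁻ v∈ = ∈-reverse⁻ (subst (_ ∈_) pool≡ v∈)

  pool-unique : Unique (pool inp [])
  pool-unique = subst Unique (sym pool≡) (Unique-resp-↭ (↭⇒↭ₛ (↭-sym (↭-reverse inp))) u)

  next : List ℕ
  next = proj₁ (pass inp [] m)

  m′ : ℕ
  m′ = proj₂ (pass inp [] m)

  next≡ : next ≡ filter (m′ ≤?_) (pool inp [])
  next≡ = pass-stack inp [] m pool-unique (m≤ ∘ ∈-pool⁻)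

  ∈-next⁺ : ∀ {v} → v ∈ inp → m′ ≤ v → v ∈ next
  ∈-next⁺ v∈ m′≤v = subst (_ ∈_) (sym next≡) (∈-filter⁺ (m′ ≤?_) (∈-pool⁺ v∈) m′≤v)

  ∈-next⁻ : ∀ {v} → v ∈ next → v ∈ inp × m′ ≤ v
  ∈-next⁻ v∈ with ∈-filter⁻ (m′ ≤?_) (subst (_ ∈_) next≡ v∈)
  ... | v∈pool , m′≤v = ∈-pool⁻ v∈pool , m′≤v

  next-unique : Unique next
  next-unique = subst Unique (sym next≡) (Unique.filter⁺ (m′ ≤?_) pool-unique)

  next-atLeast : AtLeast m′ next
  next-atLeast = proj₂ ∘ ∈-next⁻

  next⊆ : next ⊆ reverse inp
  next⊆ = subst (next ⊆_) pool≡ (subst (_⊆ pool inp []) (sym next≡) (filter-⊆ (m′ ≤?_) (pool inp [])))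

  ⊆-next : ∀ {ws} → ws ⊆ reverse inp → All (m′ ≤_) ws → ws ⊆ next
  ⊆-next p m′≤ = subst (_ ⊆_) (sym next≡) (⊆-filter m′ (subst (_ ⊆_) (sym pool≡) p) m′≤)

  blocked-at : ∀ {a b c} → (a ∷ b ∷ c ∷ []) ⊆ inp → c < a → a < b → m ≤ c → m′ ≤ a
  blocked-at {a} {b} {c} abc c<a a<b m≤c = Blocking.blocked a b c c<a a<b inp [] m abc m≤c pool-unique

  m′-stranded : ClosedFrom inp m → (Σ ℕ λ v → v ∈ next) → Occ231 inp m′
  m′-stranded cl (v , v∈) =
    Stranded.pass-strands inp inp [] m [] refl [] pool-unique (m≤ ∘ ∈-pool⁻) tt (λ _ → ∈-pool⁺) cl m′∈next
    where
    m′∈next : m′ ∈ next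
    m′∈next = ∈-next⁺ (cl (pass-mono inp [] m) (proj₂ (∈-next⁻ v∈)) (proj₁ (∈-next⁻ v∈))) ≤-refl

  next-closed : ClosedFrom inp m → ClosedFrom next m′
  next-closed cl m′≤v v≤w w∈ = ∈-next⁺ (cl (≤-trans (pass-mono inp [] m) m′≤v) v≤w (proj₁ (∈-next⁻ w∈))) m′≤v

secondStack : List ℕ → ℕ → List ℕ
secondStack inp m = proj₁ (pass (proj₁ (pass inp [] m)) [] (proj₂ (pass inp [] m)))

oneReturn⁻ : ∀ f inp m → 1 ≤ returnsFuel f inp m → Σ ℕ λ v → v ∈ proj₁ (pass inp [] m)
oneReturn⁻ zero inp m ()
oneReturn⁻ (suc f) inp m h with pass inp [] m
... | [] , _ = ⊥-elim (n≮0 h)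
... | s ∷ _ , _ = s , here refl

oneReturn⁺ : ∀ f inp m → (Σ ℕ λ v → v ∈ proj₁ (pass inp [] m)) → 1 ≤ returnsFuel (suc f) inp m
oneReturn⁺ f inp m ne with pass inp [] m
oneReturn⁺ f inp m (_ , ()) | [] , _
... | _ ∷ _ , _ = s≤s z≤n

twoReturns⁻ : ∀ f inp m → 2 ≤ returnsFuel f inp m →
              (Σ ℕ λ v → v ∈ proj₁ (pass inp [] m)) × (Σ ℕ λ v → v ∈ secondStack inp m)
twoReturns⁻ zero inp m ()
twoReturns⁻ (suc f) inp m h with pass inp [] m
... | [] , _ = ⊥-elim (n≮0 h)
... | s ∷ S , m′ = (s , here refl) , oneReturn⁻ f (s ∷ S) m′ (≤-pred h)

twoReturns⁺ : ∀ f inp m → (Σ ℕ λ v → v ∈ proj₁ (pass inp [] m)) → (Σ ℕ λ v → v ∈ secondStack inp m) →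
              2 ≤ returnsFuel (suc (suc f)) inp m
twoReturns⁺ f inp m ne₁ ne₂ with pass inp [] m
twoReturns⁺ f inp m (_ , ()) ne₂ | [] , _
... | s ∷ S , m′ = s≤s (oneReturn⁺ f (s ∷ S) m′ ne₂)

-- The first pass cannot
-- output a, so z, y, x survive it and are returned reversed as the
-- 231-occurrence x y z, which blocks the second pass.
record Obstruction (π : List ℕ) : Set where
  constructor mkObstruction
  field
    a b c z y x : ℕ
    abc⊆π : (a ∷ b ∷ c ∷ []) ⊆ π
    zyx⊆π : (z ∷ y ∷ x ∷ []) ⊆ π
    c<a : c < a
    a<b : a < b
    a≤z : a ≤ z
    z<x : z < x
    x<y : x < y

-- An obstruction forces a second return: the first pass stops before a, the
-- second before x.
obstruction⇒tier2 : ∀ π → Unique π → AtLeast 1 π → Obstruction π → 2 ≤ tRev π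
obstruction⇒tier2 [] _ _ o with Obstruction.abc⊆π o
... | ()
obstruction⇒tier2 π@(_ ∷ t) u 1≤ o = twoReturns⁺ (length t) π 1 (a , a∈next) (x , x∈second)
  where
  open Obstruction o
  module First = FromEmpty π 1 u 1≤
  m₁≤a : First.m′ ≤ a
  m₁≤a = First.blocked-at abc⊆π c<a a<b (1≤ (Any-resp-⊆ abc⊆π (there (there (here refl)))))
  a∈next : a ∈ First.next
  a∈next = First.∈-next⁺ (Any-resp-⊆ abc⊆π (here refl)) m₁≤a
  m₁≤z : First.m′ ≤ z
  m₁≤z = ≤-trans m₁≤a a≤z
  xyz⊆next : (x ∷ y ∷ z ∷ []) ⊆ First.next
  xyz⊆next = First.⊆-next (reverse⁺ zyx⊆π)
    (≤-trans m₁≤z (<⇒≤ z<x) ∷ ≤-trans m₁≤z (<⇒≤ (<-trans z<x x<y)) ∷ m₁≤z ∷ [])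
  module Second = FromEmpty First.next First.m′ First.next-unique First.next-atLeast
  x∈second : x ∈ Second.next
  x∈second = Second.∈-next⁺ (Any-resp-⊆ xyz⊆next (here refl)) (Second.blocked-at xyz⊆next z<x x<y m₁≤z)

-- Conversely, the values stranded by the first two passes, m₁ and m₂, are the
-- "2"s of 231-occurrences a b c (in π) and m₂ y z (in the returned stack,
-- i.e. z y m₂ in π), and z ≥ m₁ since z survived the first pass.
tier2⇒obstruction : ∀ π → Unique π → AtLeast 1 π → ClosedFrom π 1 → 2 ≤ tRev π → Obstruction π
tier2⇒obstruction π u 1≤ cl h =
  obstruction (First.m′-stranded cl (proj₁ returned)) (Second.m′-stranded (First.next-closed cl) (proj₂ returned))
  where
  module First = FromEmpty π 1 u 1≤
  module Second = FromEmpty First.next First.m′ First.next-unique First.next-atLeast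
  returned : (Σ ℕ λ v → v ∈ First.next) × (Σ ℕ λ v → v ∈ Second.next)
  returned = twoReturns⁻ (suc (length π)) π 1 h
  obstruction : Occ231 π First.m′ → Occ231 First.next Second.m′ → Obstruction π
  obstruction (b , c , abc , c<a , a<b) (y , z , xyz , z<x , x<y) =
    mkObstruction First.m′ b c z y Second.m′ abc
      (subst ((z ∷ y ∷ Second.m′ ∷ []) ⊆_) (reverse-involutive π) (reverse⁺ (⊆-trans xyz First.next⊆)))
      c<a a<b (proj₂ (First.∈-next⁻ (Any-resp-⊆ xyz (there (there (here refl)))))) z<x x<y

lookup-map : ∀ (g : ℕ → ℕ) σ (i : Fin (length (map g σ))) → lookup (map g σ) i ≡ g (lookup σ (cast (length-map g σ) i))
lookup-map g (_ ∷ σ) zero = refl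
lookup-map g (_ ∷ σ) (suc i) = lookup-map g σ i

reflect-< : ∀ (g : ℕ → ℕ) {p q} → (q < p → g q < g p) → g p < g q → p < q
reflect-< g {p} {q} mono gp<gq with <-cmp p q
... | tri< p<q _ _ = p<q
... | tri≈ _ refl _ = ⊥-elim (<-irrefl refl gp<gq)
... | tri> _ _ q<p = ⊥-elim (<-asym gp<gq (mono q<p))

orderIso-map : ∀ (g : ℕ → ℕ) σ → (∀ {x y} → x ∈ σ → y ∈ σ → x < y → g x < g y) → OrderIso (map g σ) σ
orderIso-map g σ mono = length-map g σ , λ i j →
  subst₂ (λ gx gy → (gx < gy) ⇔ (letter i < letter j)) (sym (lookup-map g σ i)) (sym (lookup-map g σ j))
    (mk⇔ (reflect-< g (mono (∈-lookup _) (∈-lookup _))) (mono (∈-lookup _) (∈-lookup _)))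
  where
  letter : Fin (length (map g σ)) → ℕ
  letter i = lookup σ (cast (length-map g σ) i)

-- The value of rank k (counting from 1) in a list of values.
ranked : List ℕ → ℕ → ℕ
ranked [] _ = 0
ranked (v ∷ vs) zero = 0
ranked (v ∷ vs) (suc zero) = v
ranked (v ∷ vs) (suc (suc k)) = ranked vs (suc k)

ranked-mono : ∀ {vs} → Linked _<_ vs → ∀ {x y} → 1 ≤ x → x < y → y ≤ length vs → ranked vs x < ranked vs y
ranked-mono (v<w ∷ _) {suc zero} {suc (suc zero)} _ _ _ = v<w
ranked-mono (v<w ∷ lk) {suc zero} {suc (suc (suc k))} _ _ (s≤s y≤) =
  <-trans v<w (ranked-mono lk (s≤s z≤n) (s≤s (s≤s z≤n)) y≤)
ranked-mono (_ ∷ lk) {suc (suc i)} {suc (suc j)} _ (s≤s x<y) (s≤s y≤) = ranked-mono lk (s≤s z≤n) x<y y≤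
ranked-mono [-] {suc zero} {suc (suc _)} _ _ (s≤s ())
ranked-mono [-] {suc (suc _)} {suc (suc _)} _ _ (s≤s ())
ranked-mono _ {suc _} {suc zero} _ (s≤s ())

Letters : ℕ → List ℕ → Set
Letters n σ = All (λ k → 1 ≤ k × k ≤ n) σ

letters? : ∀ n σ → Dec (Letters n σ)
letters? n = All.all? (λ k → (1 ≤? k) ×-dec (k ≤? n))

orderIso-ranked : ∀ {vs} σ → Linked _<_ vs → Letters (length vs) σ → OrderIso (map (ranked vs) σ) σ
orderIso-ranked {vs} σ lk letters = orderIso-map (ranked vs) σ λ x∈ y∈ x<y →
  ranked-mono lk (proj₁ (All.lookup letters x∈)) x<y (proj₂ (All.lookup letters y∈))

compare : ∀ {τ σ} (iso : OrderIso τ σ) (i j : Fin (length τ)) →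
          {True (lookup σ (cast (proj₁ iso) i) <? lookup σ (cast (proj₁ iso) j))} → lookup τ i < lookup τ j
compare (_ , iso) i j {holds} = Equivalence.from (iso i j) (toWitness holds)

Occ2413 : List ℕ → Set
Occ2413 π = Σ ℕ λ p → Σ ℕ λ q → Σ ℕ λ r → Σ ℕ λ s → (p ∷ q ∷ r ∷ s ∷ []) ⊆ π × r < p × p < s × s < q

Occ2431 : List ℕ → Set
Occ2431 π = Σ ℕ λ p → Σ ℕ λ q → Σ ℕ λ r → Σ ℕ λ s → (p ∷ q ∷ r ∷ s ∷ []) ⊆ π × s < p × p < r × r < q

Occ23154 : List ℕ → Set
Occ23154 π = Σ ℕ λ p → Σ ℕ λ q → Σ ℕ λ r → Σ ℕ λ s → Σ ℕ λ t →
  (p ∷ q ∷ r ∷ s ∷ t ∷ []) ⊆ π × r < p × p < q × q < t × t < s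

contains2413⇔ : ∀ {π} → Contains π (2 ∷ 4 ∷ 1 ∷ 3 ∷ []) ⇔ Occ2413 π
contains2413⇔ = mk⇔ to from
  where
  to : ∀ {π} → Contains π (2 ∷ 4 ∷ 1 ∷ 3 ∷ []) → Occ2413 π
  to ([] , _ , () , _)
  to (_ ∷ [] , _ , () , _)
  to (_ ∷ _ ∷ [] , _ , () , _)
  to (_ ∷ _ ∷ _ ∷ [] , _ , () , _)
  to (_ ∷ _ ∷ _ ∷ _ ∷ _ ∷ _ , _ , () , _)
  to (p ∷ q ∷ r ∷ s ∷ [] , sub , iso) = p , q , r , s , sub , compare iso (# 2) (# 0) , compare iso (# 0) (# 3) , compare iso (# 3) (# 1)
  from : ∀ {π} → Occ2413 π → Contains π (2 ∷ 4 ∷ 1 ∷ 3 ∷ [])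
  from (p , q , r , s , sub , r<p , p<s , s<q) =
    _ , sub , orderIso-ranked (2 ∷ 4 ∷ 1 ∷ 3 ∷ []) (r<p ∷ p<s ∷ s<q ∷ [-]) (from-yes (letters? 4 (2 ∷ 4 ∷ 1 ∷ 3 ∷ [])))

contains2431⇔ : ∀ {π} → Contains π (2 ∷ 4 ∷ 3 ∷ 1 ∷ []) ⇔ Occ2431 π
contains2431⇔ = mk⇔ to from
  where
  to : ∀ {π} → Contains π (2 ∷ 4 ∷ 3 ∷ 1 ∷ []) → Occ2431 π
  to ([] , _ , () , _)
  to (_ ∷ [] , _ , () , _)
  to (_ ∷ _ ∷ [] , _ , () , _)
  to (_ ∷ _ ∷ _ ∷ [] , _ , () , _)
  to (_ ∷ _ ∷ _ ∷ _ ∷ _ ∷ _ , _ , () , _)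
  to (p ∷ q ∷ r ∷ s ∷ [] , sub , iso) = p , q , r , s , sub , compare iso (# 3) (# 0) , compare iso (# 0) (# 2) , compare iso (# 2) (# 1)
  from : ∀ {π} → Occ2431 π → Contains π (2 ∷ 4 ∷ 3 ∷ 1 ∷ [])
  from (p , q , r , s , sub , s<p , p<r , r<q) =
    _ , sub , orderIso-ranked (2 ∷ 4 ∷ 3 ∷ 1 ∷ []) (s<p ∷ p<r ∷ r<q ∷ [-]) (from-yes (letters? 4 (2 ∷ 4 ∷ 3 ∷ 1 ∷ [])))

contains23154⇔ : ∀ {π} → Contains π (2 ∷ 3 ∷ 1 ∷ 5 ∷ 4 ∷ []) ⇔ Occ23154 π
contains23154⇔ = mk⇔ to from
  where
  to : ∀ {π} → Contains π (2 ∷ 3 ∷ 1 ∷ 5 ∷ 4 ∷ []) → Occ23154 π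
  to ([] , _ , () , _)
  to (_ ∷ [] , _ , () , _)
  to (_ ∷ _ ∷ [] , _ , () , _)
  to (_ ∷ _ ∷ _ ∷ [] , _ , () , _)
  to (_ ∷ _ ∷ _ ∷ _ ∷ [] , _ , () , _)
  to (_ ∷ _ ∷ _ ∷ _ ∷ _ ∷ _ ∷ _ , _ , () , _)
  to (p ∷ q ∷ r ∷ s ∷ t ∷ [] , sub , iso) =
    p , q , r , s , t , sub , compare iso (# 2) (# 0) , compare iso (# 0) (# 1) , compare iso (# 1) (# 4) , compare iso (# 4) (# 3)
  from : ∀ {π} → Occ23154 π → Contains π (2 ∷ 3 ∷ 1 ∷ 5 ∷ 4 ∷ [])
  from (p , q , r , s , t , sub , r<p , p<q , q<t , t<s) =
    _ , sub , orderIso-ranked (2 ∷ 3 ∷ 1 ∷ 5 ∷ 4 ∷ []) (r<p ∷ p<q ∷ q<t ∷ t<s ∷ [-]) (from-yes (letters? 5 (2 ∷ 3 ∷ 1 ∷ 5 ∷ 4 ∷ [])))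

occ2413⇒obstruction : ∀ {π} → Occ2413 π → Obstruction π
occ2413⇒obstruction (p , q , r , s , pqrs , r<p , p<s , s<q) =
  mkObstruction p q r p q s (⊆-trans (refl ∷ refl ∷ refl ∷ (s ∷ʳ [])) pqrs) (⊆-trans (refl ∷ refl ∷ (r ∷ʳ (refl ∷ []))) pqrs)
    r<p (<-trans p<s s<q) ≤-refl p<s s<q

occ2431⇒obstruction : ∀ {π} → Occ2431 π → Obstruction π
occ2431⇒obstruction (p , q , r , s , pqrs , s<p , p<r , r<q) =
  mkObstruction p q s p q r (⊆-trans (refl ∷ refl ∷ (r ∷ʳ (refl ∷ []))) pqrs) (⊆-trans (refl ∷ refl ∷ refl ∷ (s ∷ʳ [])) pqrs)
    s<p (<-trans p<r r<q) ≤-refl p<r r<q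

occ23154⇒obstruction : ∀ {π} → Occ23154 π → Obstruction π
occ23154⇒obstruction (p , q , r , s , t , pqrst , r<p , p<q , q<t , t<s) =
  mkObstruction p q r q s t (⊆-trans (refl ∷ refl ∷ refl ∷ (s ∷ʳ (t ∷ʳ []))) pqrst) (⊆-trans (p ∷ʳ (refl ∷ (r ∷ʳ (refl ∷ refl ∷ [])))) pqrst)
    r<p p<q (<⇒≤ p<q) q<t t<s

-- If a b c y x occur in this order with c < a < x < y, the position of b
-- among the values decides: 23154 when b < x, and 2413 (via a b c x) when x < b.
from-abcyx : ∀ {π a b c y x} → Unique π → (a ∷ b ∷ c ∷ y ∷ x ∷ []) ⊆ π → c < a → a < b → a < x → x < y →
             Occ2413 π ⊎ Occ23154 π
from-abcyx {π} {a} {b} {c} {y} {x} u abcyx c<a a<b a<x x<y with <-cmp b x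
... | tri< b<x _ _ = inj₂ (a , b , c , y , x , abcyx , c<a , a<b , b<x , x<y)
... | tri> _ _ x<b = inj₁ (a , b , c , x , ⊆-trans (refl ∷ refl ∷ refl ∷ (y ∷ʳ (refl ∷ []))) abcyx , c<a , a<x , x<b)
... | tri≈ _ refl _ with unique-⊆ abcyx u
...   | _ ∷ (b∉ ∷ _) = ⊥-elim (All.lookup b∉ (there (there (here refl))) refl)

-- If z y c occur in this order with c < z < x < y (and z y x in order), the
-- position of x relative to c decides: z y c x is 2413, z y x c is 2431.
from-zyc : ∀ {π z y c x} → Unique π → (z ∷ y ∷ c ∷ []) ⊆ π → (z ∷ y ∷ x ∷ []) ⊆ π → c < z → z < x → x < y →
           Occ2413 π ⊎ Occ2431 π
from-zyc {π} {z} {y} {c} {x} u zyc zyx c<z z<x x<y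
  with inSomeOrder π (Any-resp-⊆ zyc (there (there (here refl)))) (Any-resp-⊆ zyx (there (there (here refl))))
         (<⇒≢ (<-trans c<z z<x))
... | inj₁ cx = inj₁ (z , y , c , x , glue u zy (glue u (⊆-trans (z ∷ʳ (refl ∷ refl ∷ [])) zyc) cx) , c<z , z<x , x<y)
  where
  zy : (z ∷ y ∷ []) ⊆ π
  zy = ⊆-trans (refl ∷ refl ∷ (c ∷ʳ [])) zyc
... | inj₂ xc = inj₂ (z , y , x , c , glue u zy (glue u (⊆-trans (z ∷ʳ (refl ∷ refl ∷ [])) zyx) xc) , c<z , z<x , x<y)
  where
  zy : (z ∷ y ∷ []) ⊆ π
  zy = ⊆-trans (refl ∷ refl ∷ (c ∷ʳ [])) zyc

-- Every obstruction contains one of the patterns; split on whether c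
-- precedes y.
obstruction⇒occ : ∀ {π} → Unique π → Obstruction π → Occ2413 π ⊎ Occ2431 π ⊎ Occ23154 π
obstruction⇒occ {π} u (mkObstruction a b c z y x abc zyx c<a a<b a≤z z<x x<y)
  with inSomeOrder π (Any-resp-⊆ abc (there (there (here refl)))) (Any-resp-⊆ zyx (there (here refl)))
         (<⇒≢ (<-trans c<z (<-trans z<x x<y)))
  where
  c<z : c < z
  c<z = <-≤-trans c<a a≤z
... | inj₁ cy = map₂ inj₂ (from-abcyx u abcyx c<a a<b (≤-<-trans a≤z z<x) x<y)
  where
  abcyx : (a ∷ b ∷ c ∷ y ∷ x ∷ []) ⊆ π
  abcyx = glue u (⊆-trans (refl ∷ refl ∷ (c ∷ʳ [])) abc) (glue u (⊆-trans (a ∷ʳ (refl ∷ refl ∷ [])) abc)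
            (glue u cy (⊆-trans (z ∷ʳ (refl ∷ refl ∷ [])) zyx)))
... | inj₂ yc = map₂ inj₁ (from-zyc u zyc zyx (<-≤-trans c<a a≤z) z<x x<y)
  where
  zyc : (z ∷ y ∷ c ∷ []) ⊆ π
  zyc = glue u (⊆-trans (refl ∷ refl ∷ (x ∷ʳ [])) zyx) yc

∈-oneTo⁻ : ∀ {n v} → v ∈ oneTo n → 1 ≤ v × v ≤ n
∈-oneTo⁻ v∈ with ∈-map⁻ suc v∈
... | _ , k∈ , refl = s≤s z≤n , ∈-upTo⁻ k∈

∈-oneTo⁺ : ∀ {n v} → 1 ≤ v → v ≤ n → v ∈ oneTo n
∈-oneTo⁺ {v = suc k} _ v≤n = ∈-map⁺ suc (∈-upTo⁺ v≤n)

module PermutationOfOneTo {n : ℕ} {π : List ℕ} (π↭ : π ↭ oneTo n) where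

  unique : Unique π
  unique = Unique-resp-↭ (↭⇒↭ₛ (↭-sym π↭)) (Unique.map⁺ suc-injective (Unique.upTo⁺ n))

  atLeast1 : AtLeast 1 π
  atLeast1 v∈ = proj₁ (∈-oneTo⁻ (∈-resp-↭ π↭ v∈))

  closed : ClosedFrom π 1
  closed 1≤v v≤w w∈ = ∈-resp-↭ (↭-sym π↭) (∈-oneTo⁺ 1≤v (≤-trans v≤w (proj₂ (∈-oneTo⁻ (∈-resp-↭ π↭ w∈)))))

tier2⇔contains : ∀ {n π} → π ↭ oneTo n → 2 ≤ tRev π ⇔
  (Contains π (2 ∷ 4 ∷ 1 ∷ 3 ∷ []) ⊎ Contains π (2 ∷ 4 ∷ 3 ∷ 1 ∷ []) ⊎ Contains π (2 ∷ 3 ∷ 1 ∷ 5 ∷ 4 ∷ []))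
tier2⇔contains {π = π} π↭ = ⇔-trans tier2⇔occ (⇔-sym (contains2413⇔ ⊎-⇔ contains2431⇔ ⊎-⇔ contains23154⇔))
  where
  open PermutationOfOneTo π↭
  tier2⇔occ : 2 ≤ tRev π ⇔ (Occ2413 π ⊎ Occ2431 π ⊎ Occ23154 π)
  tier2⇔occ = mk⇔ (obstruction⇒occ unique ∘ tier2⇒obstruction π unique atLeast1 closed)
    (obstruction⇒tier2 π unique atLeast1 ∘ [ occ2413⇒obstruction , [ occ2431⇒obstruction , occ23154⇒obstruction ]′ ]′)

mainTheorem4 : (n : ℕ) (π : List ℕ) → π ↭ oneTo n →
    RevPassSortable 2 π ⇔
    (Avoids π (2 ∷ 4 ∷ 1 ∷ 3 ∷ []) × Avoids π (2 ∷ 4 ∷ 3 ∷ 1 ∷ [])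
    × Avoids π (2 ∷ 3 ∷ 1 ∷ 5 ∷ 4 ∷ []))
mainTheorem4 n π π↭ = mk⇔ sortable⇒avoids avoids⇒sortable
  where
  open Equivalence (tier2⇔contains π↭)
  AvoidsAll : Set
  AvoidsAll = Avoids π (2 ∷ 4 ∷ 1 ∷ 3 ∷ []) × Avoids π (2 ∷ 4 ∷ 3 ∷ 1 ∷ []) × Avoids π (2 ∷ 3 ∷ 1 ∷ 5 ∷ 4 ∷ [])
  sortable⇒avoids : RevPassSortable 2 π → AvoidsAll
  sortable⇒avoids sortable = let ¬tier2 = <⇒≱ sortable in
    ¬tier2 ∘ from ∘ inj₁ , ¬tier2 ∘ from ∘ inj₂ ∘ inj₁ , ¬tier2 ∘ from ∘ inj₂ ∘ inj₂
  avoids⇒sortable : AvoidsAll → RevPassSortable 2 π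
  avoids⇒sortable (no2413 , no2431 , no23154) = ≰⇒> ((no2413 ¬-⊎ no2431 ¬-⊎ no23154) ∘ to)
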